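{- Let $P$ be a query problem, let $n$ be the input size, and let $D(P,n)$ and $D_k(P,n)$ be as defined in the context. Then: (i) for every integer $k\ge 0$, $D_k(P,n)\le D(P,n)$; (ii) for every integer $k\ge 0$, $$D_k(P,n)\le \min\Big\{\sum_{i=1}^{l} D_{j_i}(P,n)\;:\; l\ge 1,\ j_1,\dots,j_l\ge 0 \text{ integers},\ \sum_{i=1}^{l}(j_i+1)>k\Big\}.$$
   Context: A query problem $P$ (on inputs of size $n$) consists of a finite set $X$ of inputs, a function $f:X\to Y$, and a set of allowed queries, each query being a function on $X$ whose value at the input is its answer. An input $x$ is consistent with a set of answered queries if each of those queries has the recorded answer on $x$. The goal is to determine $f(x)$ for the unknown input $x$; the process ends as soon as all inputs consistent with the answers so far have the same value of $f$. $D(P,n)$ (deterministic query complexity) is the minimum, over all adaptive query strategies (decision trees), of the maximum over inputs $x\in X$ of the number of queries asked before $f(x)$ is determined. For an integer $k\ge 0$, $D_k(P,n)$ is defined by the following game between a Questioner and an Adversary. The Adversary first chooses an input. The Questioner, who at every moment knows the current input, asks allowed queries one at a time. Before answering a query, the Adversary may replace the current input by any input consistent with all answers given so far (those answers stay fixed), but he may do this at most $k$ times in total; each query is answered according to the current input. The game ends when all inputs consistent with the answers given so far have the same value of $f$. $D_k(P,n)$ is the number of queries asked when the Questioner plays to minimize and the Adversary plays to maximize this number. ($D_0(P,n)$ is the non-deterministic / certificate complexity.) -}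

module Defs where

open import Level using (Level; _⊔_) renaming (suc to lsuc)
open import Data.Nat using (ℕ; zero; suc; _+_; _≤_; _>_)
open import Data.List using (List; []; _∷_; map)

open import Data.List.Membership.Propositional using (_∈_)
open import Data.List.Relation.Binary.Pointwise using (Pointwise)
open import Data.Product using (_×_; _,_)
open import Relation.Binary.PropositionalEquality using (_≡_)

-- A query problem (on inputs of a fixed size n): a finite set of inputs,
-- a function f on inputs, and a set of allowed queries, each query being
-- a function on the inputs (its value at the input is the answer).
record QueryProblem : Set₁ where
  field
    Input   : Set
    Output  : Set
    Query   : Set
    Answer  : Set
    f       : Input → Output
    ask     : Query → Input → Answer
    inputs   : List Input
    complete : ∀ x → x ∈ inputs

module _ (P : QueryProblem) where
  open QueryProblem P

  History : Set
  History = List (Query × Answer)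

  Consistent : Input → History → Set
  Consistent x []            = Data.Unit.⊤
    where import Data.Unit
  Consistent x ((q , a) ∷ h) = (ask q x ≡ a) × Consistent x h

  Determined : History → Set
  Determined h = ∀ x y → Consistent x h → Consistent y h → f x ≡ f y

  -- Deterministic decision trees: DetWin h d means some adaptive query
  -- strategy, starting from history h, determines f(x) within d further
  -- queries for every input x consistent with h.
  data DetWin (h : History) : ℕ → Set where
    done : ∀ {d} → Determined h → DetWin h d
    query : ∀ {d} (q : Query) →
            (∀ x → Consistent x h → DetWin ((q , ask q x) ∷ h) d) →
            DetWin h (suc d)

  DetBound : ℕ → Set
  DetBound d = DetWin [] d

  IsD : ℕ → Set
  IsD d = DetBound d × (∀ e → DetBound e → d ≤ e)

  -- The k-change game: GameWin h x c d means that in the position with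
  -- answers h, current input x and c remaining changes for the Adversary,
  -- the Questioner (knowing x) can force the game to end within d more
  -- queries.  Before answering the chosen query the Adversary either keeps x,
  -- or (if c = suc c') replaces it by any input y consistent with h.
  data GameWin (h : History) (x : Input) : ℕ → ℕ → Set where
    done : ∀ {c d} → Determined h → GameWin h x c d
    query : ∀ {c d} (q : Query) →
            GameWin ((q , ask q x) ∷ h) x c d →
            (∀ c' → c ≡ suc c' → ∀ y → Consistent y h →
               GameWin ((q , ask q y) ∷ h) y c' d) →
            GameWin h x c (suc d)

  -- D_k(P,n) ≤ d : for every initial choice of the Adversary
  GameBound : ℕ → ℕ → Set
  GameBound k d = ∀ x → GameWin [] x k d

  IsDk : ℕ → ℕ → Set
  IsDk k d = GameBound k d × (∀ e → GameBound k e → d ≤ e)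

module Submission where

-- Both bounds are proved by turning strategies into strategies.
--
-- (i)  A decision tree is a Questioner strategy that never looks at the
--      current input, so it wins the game against any number of changes
--      within its depth (detWin⇒gameWin).  Minimality of D_k gives D_k ≤ D.
--
-- (ii) Strategies can be concatenated (gameWin-then): play a strategy that
--      copes with j changes; as soon as the Adversary makes his (j+1)-th
--      change, start afresh with a strategy for the empty history, which is
--      still winning because earlier answers only shrink the set of
--      consistent inputs (gameWin-refine).  This copes with j + 1 + c
--      changes at cost d₁ + d₂.  Iterating along a list (gameBound-sequence)
--      shows that strategies for j₁, …, j_l changes combine to one for
--      Σ (jᵢ + 1) - 1 changes of cost Σ dᵢ; since k < Σ (jᵢ + 1) and fewer
--      changes only help the Questioner (gameWin-fewer-changes), minimality
--      of D_k gives D_k ≤ Σ D_{jᵢ}.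

open import Defs
open import Data.Nat using (ℕ; zero; suc; _+_; _≤_; _>_; z≤n; s≤s; s≤s⁻¹)
open import Data.Nat.Properties using (+-identityʳ; m≤n+m)
open import Data.List using (List; []; _∷_; map)
open import Data.Nat.ListAction using (sum)
open import Data.List.Relation.Binary.Pointwise using (Pointwise; []; _∷_)
import Data.List.Relation.Binary.Pointwise as Pointwise
open import Data.Product using (_×_; _,_; proj₁)
open import Data.Unit using (tt)
open import Data.Empty using (⊥-elim)
open import Relation.Nullary using (¬_)
open import Relation.Binary.PropositionalEquality using (_≡_; refl; sym; subst₂)

module _ (P : QueryProblem) where
  open QueryProblem P

  -- A decision tree of depth d wins the game with any number of changes:
  -- it answers every current input the way the tree branches on it.
  detWin⇒gameWin : ∀ {h x c d} → DetWin P h d → Consistent P x h →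
                   GameWin P h x c d
  detWin⇒gameWin (done det) _ = done det
  detWin⇒gameWin {x = x} (query q branch) cx =
    query q (detWin⇒gameWin (branch x cx) (refl , cx))
            (λ _ _ y cy → detWin⇒gameWin (branch y cy) (refl , cy))

  gameWin-more-queries : ∀ {h x c d d′} → GameWin P h x c d → d ≤ d′ →
                         GameWin P h x c d′
  gameWin-more-queries (done det) _ = done det
  gameWin-more-queries (query q stay change) (s≤s d≤d′) =
    query q (gameWin-more-queries stay d≤d′)
            (λ c′ eq y cy → gameWin-more-queries (change c′ eq y cy) d≤d′)

  gameWin-fewer-changes : ∀ {h x c c′ d} → GameWin P h x c d → c′ ≤ c →
                          GameWin P h x c′ d
  gameWin-fewer-changes (done det) _ = done det
  gameWin-fewer-changes (query q stay change) z≤n =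
    query q (gameWin-fewer-changes stay z≤n) (λ _ ())
  gameWin-fewer-changes (query q stay change) (s≤s c′≤c) =
    query q (gameWin-fewer-changes stay (s≤s c′≤c))
            (λ { _ refl y cy → gameWin-fewer-changes (change _ refl y cy) c′≤c })

  -- A strategy stays winning from a history h₂ that admits fewer inputs than
  -- h₁: every answer it will see is then also consistent from h₁.
  gameWin-refine : ∀ {h₁ h₂ x c d} → GameWin P h₁ x c d →
                   (∀ z → Consistent P z h₂ → Consistent P z h₁) →
                   GameWin P h₂ x c d
  gameWin-refine (done det) h₂⊆h₁ =
    done (λ x y cx cy → det x y (h₂⊆h₁ x cx) (h₂⊆h₁ y cy))
  gameWin-refine (query q stay change) h₂⊆h₁ =
    query q (gameWin-refine stay extend)
            (λ c′ eq y cy → gameWin-refine (change c′ eq y (h₂⊆h₁ y cy)) extend)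
    where
    extend : ∀ {qa} z → Consistent P z (qa ∷ _) → Consistent P z (qa ∷ _)
    extend z (az , cz) = az , h₂⊆h₁ z cz

  gameWin-from-start : ∀ {h x c d} → GameWin P [] x c d → GameWin P h x c d
  gameWin-from-start w = gameWin-refine w (λ _ _ → tt)

  -- Concatenation: follow a strategy coping with j changes; when the
  -- Adversary spends his (j+1)-th change, switch to a fresh start strategy
  -- coping with the c changes that remain.
  gameWin-then : ∀ {h x j c d₁ d₂} → GameWin P h x j d₁ →
                 GameBound P c d₂ → GameWin P h x (j + suc c) (d₁ + d₂)
  gameWin-then (done det) _ = done det
  gameWin-then {j = zero} {d₂ = d₂} (query {d = d₁} q stay _) restart =
    query q (gameWin-then stay restart)
            (λ { _ refl y _ → gameWin-more-queries
                                 (gameWin-from-start (restart y))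
                                 (m≤n+m d₂ d₁) })
  gameWin-then {j = suc j} (query q stay change) restart =
    query q (gameWin-then stay restart)
            (λ { _ refl y cy → gameWin-then (change j refl y cy) restart })

  gameBound-sequence : ∀ {j d} js ds → GameBound P j d →
                       Pointwise (GameBound P) js ds →
                       GameBound P (j + sum (map suc js)) (d + sum ds)
  gameBound-sequence {j} {d} [] [] bound [] =
    subst₂ (GameBound P) (sym (+-identityʳ j)) (sym (+-identityʳ d)) bound
  gameBound-sequence (_ ∷ js) (_ ∷ ds) bound (next ∷ rest) x =
    gameWin-then (bound x) (gameBound-sequence js ds next rest)

proposition1 : (P : QueryProblem) →
    ((k d e : ℕ) → IsD P d → IsDk P k e → e ≤ d)
    × ((k e : ℕ) → IsDk P k e →
    (js ds : List ℕ) → ¬ (js ≡ []) →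
    sum (map suc js) > k →
    Pointwise (λ j dj → IsDk P j dj) js ds →
    e ≤ sum ds)
proposition1 P = part-i , part-ii
  where
  part-i : (k d e : ℕ) → IsD P d → IsDk P k e → e ≤ d
  part-i k d e (tree , _) (_ , minimal) =
    minimal d (λ x → detWin⇒gameWin P tree tt)

  part-ii : (k e : ℕ) → IsDk P k e → (js ds : List ℕ) → ¬ (js ≡ []) →
            sum (map suc js) > k → Pointwise (λ j dj → IsDk P j dj) js ds →
            e ≤ sum ds
  part-ii k e _ [] _ nonempty _ _ = ⊥-elim (nonempty refl)
  part-ii k e (_ , minimal) (j ∷ js) (d ∷ ds) _ k<total (isDj ∷ isDjs) =
    minimal (sum (d ∷ ds)) λ x →
      gameWin-fewer-changes P (combined x) (s≤s⁻¹ k<total)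
    where
    combined : GameBound P (j + sum (map suc js)) (d + sum ds)
    combined = gameBound-sequence P js ds (proj₁ isDj)
                 (Pointwise.map proj₁ isDjs)
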